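{- Let $G=(V,E)$ be a strongly biconnected directed graph and let $U\subseteq E$ be such that the directed subgraph $G_1=(V,U)$ is strongly connected but the underlying undirected graph of $G_1$ is not biconnected. Let $(v,w)\in E\setminus U$ be an edge such that $v$ and $w$ are not in the same strongly biconnected component of $G_1$. Then the directed subgraph $(V,U\cup\{(v,w)\})$ has fewer strongly biconnected components than $G_1$.
   Context: A directed graph is strongly biconnected if it is strongly connected and its underlying undirected graph is biconnected. A strongly biconnected component of a directed graph is a maximal strongly biconnected subgraph of it (in the sense of Wu and Grumbach). -}

module Defs where

open import Data.Nat using (ℕ)
open import Data.Fin using (Fin)
open import Data.Fin.Subset using (Subset; _∈_; _∉_; _⊆_; _∪_; _─_; ⁅_⁆)
open import Data.Vec using (Vec; lookup; updateAt)
open import Data.Product using (Σ; ∃; _×_; _,_)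
open import Relation.Binary.PropositionalEquality using (_≡_)
open import Function.Definitions using (Injective)
open import Function.Bundles using (_⇔_)

-- Directed graphs on the vertex set Fin n.  An edge set is an adjacency
-- matrix: row u is the set of out-neighbours of u.
EdgeSet : ℕ → Set
EdgeSet n = Vec (Subset n) n

module _ {n : ℕ} where

  _⟶_∈E_ : Fin n → Fin n → EdgeSet n → Set
  u ⟶ v ∈E F = v ∈ lookup F u

  _⊆E_ : EdgeSet n → EdgeSet n → Set
  F ⊆E F' = ∀ u v → u ⟶ v ∈E F → u ⟶ v ∈E F'

  addEdge : EdgeSet n → Fin n → Fin n → EdgeSet n
  addEdge F v w = updateAt F v (λ s → s ∪ ⁅ w ⁆)

  data Path (F : EdgeSet n) : Fin n → Fin n → Set where
    stop : ∀ {x} → Path F x x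
    step : ∀ {x y z} → x ⟶ y ∈E F → Path F y z → Path F x z

  -- path in the underlying undirected graph of F, all of whose vertices
  -- after the start lie in S
  data UPath (S : Subset n) (F : EdgeSet n) : Fin n → Fin n → Set where
    stop : ∀ {x} → UPath S F x x
    fwd  : ∀ {x y z} → x ⟶ y ∈E F → y ∈ S → UPath S F y z → UPath S F x z
    bwd  : ∀ {x y z} → y ⟶ x ∈E F → y ∈ S → UPath S F y z → UPath S F x z

  IsSubgraph : EdgeSet n → Subset n → EdgeSet n → Set
  IsSubgraph E S F = F ⊆E E × (∀ u v → u ⟶ v ∈E F → u ∈ S × v ∈ S)

  StronglyConnected : Subset n → EdgeSet n → Set
  StronglyConnected S F = ∀ x y → x ∈ S → y ∈ S → Path F x y

  UConnected : Subset n → EdgeSet n → Set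
  UConnected S F = ∀ x y → x ∈ S → y ∈ S → UPath S F x y

  Biconnected : Subset n → EdgeSet n → Set
  Biconnected S F = UConnected S F × (∀ z → z ∈ S → UConnected (S ─ ⁅ z ⁆) F)

  StronglyBiconnected : Subset n → EdgeSet n → Set
  StronglyBiconnected S F = StronglyConnected S F × Biconnected S F

  IsSBC : EdgeSet n → Subset n × EdgeSet n → Set
  IsSBC E (S , F) =
    IsSubgraph E S F × StronglyBiconnected S F ×
    (∀ S' F' → IsSubgraph E S' F' → StronglyBiconnected S' F' →
       S ⊆ S' → F ⊆E F' → (S' , F') ≡ (S , F))

HasCount : ∀ {A : Set} → (A → Set) → ℕ → Set
HasCount {A} P k =
  Σ (Fin k → A) λ f → Injective _≡_ _≡_ f × (∀ x → P x ⇔ ∃ λ i → f i ≡ x)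

NumSBC : ∀ {n} → EdgeSet n → ℕ → Set
NumSBC E k = HasCount (IsSBC E) k

{-# OPTIONS --safe #-}
-- Adding (v, w) closes a simple path P from w to v in U into a cycle. A strongly biconnected
-- subgraph meeting this cycle in two vertices can be enlarged by it, so an SBC of U containing
-- two vertices of P is not an SBC of U + (v, w). This applies to the SBC A₀ around the first
-- edge of P and to the SBC A₁ around its last edge, and A₀ ≠ A₁ since v and w lie in no common
-- SBC of U. An SBC of U + (v, w) avoiding the new edge is an SBC of U, and at most one contains
-- the new edge; sending that one to A₀ injects the SBCs of U + (v, w) into those of U, missing
-- A₁. Maximal extensions exist only under double negation, which is harmless since the
-- conclusion is decidable.
module Submission where

open import Defs
open import Data.Nat using (ℕ; zero; suc; _<_; _≤_; _+_; _*_; z≤n; s≤s; _<?_)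
import Data.Nat.Properties as ℕ
open import Data.Bool.Properties using () renaming (_≟_ to _≟ᵇ_)
open import Data.Fin using (Fin; zero; suc; punchOut)
open import Data.Fin.Properties using (_≟_; punchOut-injective; injective⇒≤)
open import Data.Fin.Subset using (Subset; _∈_; _∉_; _⊆_; _∪_; _∩_; _─_; _-_; ⁅_⁆; ⊤; ⊥; ∣_∣; outside)
open import Data.Fin.Subset.Properties
  using (_∈?_; _⊂?_; ∈⊤; ∉⊥; x∈⁅x⁆; x∈⁅y⁆⇒x≡y; x∈p∪q⁺; x∈p∪q⁻; x∈p∩q⁺; x∈p∩q⁻; p─q⊆p;
         x∈p∧x≢y⇒x∈p-y; ⊆-antisym; ∣p∣≤n; p⊆q⇒∣p∣≤∣q∣; p⊂q⇒∣p∣<∣q∣)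
open import Data.Vec using (Vec; []; _∷_; here; there; replicate; lookup; zipWith; tabulate)
import Data.Vec.Properties as Vec
open import Data.Product using (Σ; _×_; _,_; proj₁; proj₂)
import Data.Product.Properties as Product
open import Data.Sum using (_⊎_; inj₁; inj₂)
open import Data.Empty using (⊥-elim)
open import Data.Unit using (tt) renaming (⊤ to Unit)
open import Effect.Monad using (RawMonad)
open import Function using (_∘_; id)
open import Function.Bundles using (module Equivalence)
open import Function.Definitions using (Injective)
open import Level using (0ℓ)
open import Relation.Nullary using (¬_; Dec; yes; no; contradiction)
open import Relation.Nullary.Decidable using (decidable-stable; ¬¬-excluded-middle)
open import Relation.Nullary.Negation using (¬¬-Monad; DoubleNegation)
open import Relation.Binary.PropositionalEquality using (_≡_; _≢_; refl; sym; cong; cong₂; subst; subst₂; module ≡-Reasoning)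

x∈p─q⇒x∉q : ∀ {n} {x : Fin n} (p q : Subset n) → x ∈ p ─ q → x ∉ q
x∈p─q⇒x∉q (_ ∷ p) (outside ∷ q) here ()
x∈p─q⇒x∉q (_ ∷ p) (_ ∷ q) (there x∈p─q) (there x∈q) = x∈p─q⇒x∉q p q x∈p─q x∈q

module _ {n : ℕ} where

  x∈p-y⇒x≢y : ∀ {x y : Fin n} (p : Subset n) → x ∈ p - y → x ≢ y
  x∈p-y⇒x≢y {x} p x∈p-y refl = x∈p─q⇒x∉q p ⁅ x ⁆ x∈p-y (x∈⁅x⁆ x)

  x∈p-y⇒x∈p : ∀ {x y : Fin n} (p : Subset n) → x ∈ p - y → x ∈ p
  x∈p-y⇒x∈p {y = y} p = p─q⊆p p ⁅ y ⁆

  infixr 25 _∪ᴱ_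

  _∪ᴱ_ : EdgeSet n → EdgeSet n → EdgeSet n
  F ∪ᴱ F' = zipWith _∪_ F F'

  ∪ᴱ⁻ : ∀ {F F' : EdgeSet n} {u y} → u ⟶ y ∈E F ∪ᴱ F' → u ⟶ y ∈E F ⊎ u ⟶ y ∈E F'
  ∪ᴱ⁻ {F} {F'} {u} {y} e = x∈p∪q⁻ (lookup F u) (lookup F' u) (subst (y ∈_) (Vec.lookup-zipWith _∪_ u F F') e)

  F⊆F∪ᴱF' : ∀ {F F' : EdgeSet n} → F ⊆E F ∪ᴱ F'
  F⊆F∪ᴱF' {F} {F'} u y e = subst (y ∈_) (sym (Vec.lookup-zipWith _∪_ u F F')) (x∈p∪q⁺ (inj₁ e))

  F'⊆F∪ᴱF' : ∀ {F F' : EdgeSet n} → F' ⊆E F ∪ᴱ F'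
  F'⊆F∪ᴱF' {F} {F'} u y e = subst (y ∈_) (sym (Vec.lookup-zipWith _∪_ u F F')) (x∈p∪q⁺ (inj₂ e))

  inducedRow : EdgeSet n → Subset n → Fin n → Subset n
  inducedRow G S u with u ∈? S
  ... | yes _ = lookup G u ∩ S
  ... | no _ = ⊥

  induced : EdgeSet n → Subset n → EdgeSet n
  induced G S = tabulate (inducedRow G S)

  ∈induced⁻ : ∀ {G S} {u y : Fin n} → u ⟶ y ∈E induced G S → u ∈ S × y ∈ S × u ⟶ y ∈E G
  ∈induced⁻ {G} {S} {u} {y} e = fromRow (subst (y ∈_) (Vec.lookup∘tabulate (inducedRow G S) u) e)
    where
    fromRow : y ∈ inducedRow G S u → u ∈ S × y ∈ S × u ⟶ y ∈E G
    fromRow e with u ∈? S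
    ... | yes u∈S = u∈S , proj₂ (x∈p∩q⁻ _ _ e) , proj₁ (x∈p∩q⁻ _ _ e)
    ... | no _ = ⊥-elim (∉⊥ e)

  ∈induced⁺ : ∀ {G S} {u y : Fin n} → u ∈ S → y ∈ S → u ⟶ y ∈E G → u ⟶ y ∈E induced G S
  ∈induced⁺ {G} {S} {u} {y} u∈S y∈S e = subst (y ∈_) (sym (Vec.lookup∘tabulate (inducedRow G S) u)) toRow
    where
    toRow : y ∈ inducedRow G S u
    toRow with u ∈? S
    ... | yes _ = x∈p∩q⁺ (e , y∈S)
    ... | no u∉S = contradiction u∈S u∉S

  induced-isSubgraph : ∀ G S → IsSubgraph G S (induced G S)
  induced-isSubgraph G S =
    (λ _ _ e → proj₂ (proj₂ (∈induced⁻ e))) , λ _ _ e → proj₁ (∈induced⁻ e) , proj₁ (proj₂ (∈induced⁻ e))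

  addEdge⁻ : ∀ {U : EdgeSet n} {v w u y} → u ⟶ y ∈E addEdge U v w → u ⟶ y ∈E U ⊎ (u ≡ v × y ≡ w)
  addEdge⁻ {U} {v} {w} {u} {y} e with u ≟ v
  ... | no u≢v = inj₁ (subst (y ∈_) (Vec.lookup∘updateAt′ u v u≢v U) e)
  ... | yes refl with x∈p∪q⁻ (lookup U u) ⁅ w ⁆ (subst (y ∈_) (Vec.lookup∘updateAt u U) e)
  ...   | inj₁ old = inj₁ old
  ...   | inj₂ new = inj₂ (refl , x∈⁅y⁆⇒x≡y w new)

  U⊆addEdge : ∀ {U : EdgeSet n} {v w} → U ⊆E addEdge U v w
  U⊆addEdge {U} {v} u y e with u ≟ v
  ... | yes refl = subst (y ∈_) (sym (Vec.lookup∘updateAt u U)) (x∈p∪q⁺ (inj₁ e))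
  ... | no u≢v = subst (y ∈_) (sym (Vec.lookup∘updateAt′ u v u≢v U)) e

  ∈addEdge : ∀ {U : EdgeSet n} {v w} → v ⟶ w ∈E addEdge U v w
  ∈addEdge {U} {v} {w} = subst (w ∈_) (sym (Vec.lookup∘updateAt v U)) (x∈p∪q⁺ (inj₂ (x∈⁅x⁆ w)))

  _++ᴾ_ : ∀ {F : EdgeSet n} {x y z} → Path F x y → Path F y z → Path F x z
  stop ++ᴾ q = q
  step e p ++ᴾ q = step e (p ++ᴾ q)

  mapᴾ : ∀ {F F' : EdgeSet n} {x y} → F ⊆E F' → Path F x y → Path F' x y
  mapᴾ F⊆F' stop = stop
  mapᴾ F⊆F' (step e p) = step (F⊆F' _ _ e) (mapᴾ F⊆F' p)

  _++ᵁ_ : ∀ {S} {F : EdgeSet n} {x y z} → UPath S F x y → UPath S F y z → UPath S F x z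
  stop ++ᵁ q = q
  fwd e m p ++ᵁ q = fwd e m (p ++ᵁ q)
  bwd e m p ++ᵁ q = bwd e m (p ++ᵁ q)

  mapᵁ : ∀ {S S'} {F F' : EdgeSet n} {x y} → (∀ {u} → u ∈ S → u ∈ S') → F ⊆E F' → UPath S F x y → UPath S' F' x y
  mapᵁ S⊆S' F⊆F' stop = stop
  mapᵁ S⊆S' F⊆F' (fwd e m p) = fwd (F⊆F' _ _ e) (S⊆S' m) (mapᵁ S⊆S' F⊆F' p)
  mapᵁ S⊆S' F⊆F' (bwd e m p) = bwd (F⊆F' _ _ e) (S⊆S' m) (mapᵁ S⊆S' F⊆F' p)

  reverseᵁ : ∀ {S} {F : EdgeSet n} {x y} → x ∈ S → UPath S F x y → UPath S F y x
  reverseᵁ x∈S stop = stop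
  reverseᵁ x∈S (fwd e m p) = reverseᵁ m p ++ᵁ bwd e x∈S stop
  reverseᵁ x∈S (bwd e m p) = reverseᵁ m p ++ᵁ fwd e x∈S stop

  Path⇒UPath : ∀ {S} {F : EdgeSet n} {x y} → (∀ u y → u ⟶ y ∈E F → y ∈ S) → Path F x y → UPath S F x y
  Path⇒UPath F⊆S stop = stop
  Path⇒UPath F⊆S (step e p) = fwd e (F⊆S _ _ e) (Path⇒UPath F⊆S p)

  UPath-end≢ : ∀ {S z} {F : EdgeSet n} {x y} → UPath (S - z) F x y → x ≢ z → y ≢ z
  UPath-end≢ stop x≢z = x≢z
  UPath-end≢ {S} (fwd e m p) _ = UPath-end≢ p (x∈p-y⇒x≢y S m)
  UPath-end≢ {S} (bwd e m p) _ = UPath-end≢ p (x∈p-y⇒x≢y S m)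

  data On {F : EdgeSet n} : Fin n → ∀ {x y} → Path F x y → Set where
    onHere : ∀ {x y} {p : Path F x y} → On x p
    onThere : ∀ {u x y z} {e : x ⟶ y ∈E F} {p : Path F y z} → On u p → On u (step e p)

  On? : ∀ {F : EdgeSet n} {x y} (u : Fin n) (p : Path F x y) → Dec (On u p)
  On? u (stop {x}) with u ≟ x
  ... | yes refl = yes onHere
  ... | no u≢x = no λ { onHere → u≢x refl }
  On? u (step {x} e p) with u ≟ x
  ... | yes refl = yes onHere
  ... | no u≢x with On? u p
  ...   | yes u∈p = yes (onThere u∈p)
  ...   | no u∉p = no λ { onHere → u≢x refl ; (onThere u∈p) → u∉p u∈p }

  On-end : ∀ {F : EdgeSet n} {x y} (p : Path F x y) → On y p
  On-end stop = onHere
  On-end (step e p) = onThere (On-end p)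

  Simple : ∀ {F : EdgeSet n} {x y} → Path F x y → Set
  Simple stop = Unit
  Simple (step {x} e p) = ¬ On x p × Simple p

  SimplePath : EdgeSet n → Fin n → Fin n → Set
  SimplePath F x y = Σ (Path F x y) Simple

  dropUntil : ∀ {F : EdgeSet n} {x z u} (p : Path F x z) → Simple p → On u p → SimplePath F u z
  dropUntil p s onHere = p , s
  dropUntil (step e p) (_ , s) (onThere u∈p) = dropUntil p s u∈p

  simplify : ∀ {F : EdgeSet n} {x z} → Path F x z → SimplePath F x z
  simplify stop = stop , tt
  simplify (step {x} e p) with simplify p
  ... | q , q-simple with On? x q
  ...   | yes x∈q = dropUntil q q-simple x∈q
  ...   | no x∉q = step e q , x∉q , q-simple

  lastEdge : ∀ {F : EdgeSet n} {x y} (p : Path F x y) → Simple p → x ≢ y →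
    Σ (Fin n) λ u → u ⟶ y ∈E F × u ≢ y × On u p
  lastEdge stop _ x≢y = contradiction refl x≢y
  lastEdge {y = y} (step {x} {x'} e p) (_ , s) x≢y with x' ≟ y
  ... | yes refl = x , e , x≢y , onHere
  ... | no x'≢y with lastEdge p s x'≢y
  ...   | u , e' , u≢y , u∈p = u , e' , u≢y , onThere u∈p

  vertices : ∀ {F : EdgeSet n} {x y} → Path F x y → Subset n
  vertices (stop {x}) = ⁅ x ⁆
  vertices (step {x} e p) = ⁅ x ⁆ ∪ vertices p

  ∈vertices⁺ : ∀ {F : EdgeSet n} {x y u} (p : Path F x y) → On u p → u ∈ vertices p
  ∈vertices⁺ stop onHere = x∈⁅x⁆ _
  ∈vertices⁺ (step e p) onHere = x∈p∪q⁺ (inj₁ (x∈⁅x⁆ _))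
  ∈vertices⁺ (step e p) (onThere u∈p) = x∈p∪q⁺ (inj₂ (∈vertices⁺ p u∈p))

  ∈vertices⁻ : ∀ {F : EdgeSet n} {x y u} (p : Path F x y) → u ∈ vertices p → On u p
  ∈vertices⁻ (stop {x}) m = subst (λ t → On t stop) (sym (x∈⁅y⁆⇒x≡y x m)) onHere
  ∈vertices⁻ (step {x} e p) m with x∈p∪q⁻ ⁅ x ⁆ (vertices p) m
  ... | inj₁ m = subst (λ t → On t (step e p)) (sym (x∈⁅y⁆⇒x≡y x m)) onHere
  ... | inj₂ m = onThere (∈vertices⁻ p m)

  -- A simple path from a to b in H ⊆ G, closed by an edge b ⟶ a of G, spans a strongly
  -- biconnected subgraph of G: its vertices with all edges of G between them.
  module ClosedPath (G H : EdgeSet n) (H⊆G : H ⊆E G) {a b : Fin n} (P : Path H a b) (P-simple : Simple P)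
                    (b⟶a : b ⟶ a ∈E G) where

    S : Subset n
    S = vertices P

    F : EdgeSet n
    F = induced G S

    isSubgraph : IsSubgraph G S F
    isSubgraph = induced-isSubgraph G S

    On⇒∈S : ∀ {u} → On u P → u ∈ S
    On⇒∈S = ∈vertices⁺ P

    a∈S : a ∈ S
    a∈S = On⇒∈S onHere

    b∈S : b ∈ S
    b∈S = On⇒∈S (On-end P)

    lift : ∀ {x y} → x ⟶ y ∈E H → x ∈ S → y ∈ S → x ⟶ y ∈E F
    lift e x∈S y∈S = ∈induced⁺ x∈S y∈S (H⊆G _ _ e)

    b⟶a∈F : b ⟶ a ∈E F
    b⟶a∈F = ∈induced⁺ b∈S a∈S b⟶a

    liftᴾ : ∀ {x y} (q : Path H x y) → (∀ {u} → On u q → u ∈ S) → Path F x y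
    liftᴾ stop _ = stop
    liftᴾ (step e q) q⊆S = step (lift e (q⊆S onHere) (q⊆S (onThere onHere))) (liftᴾ q (q⊆S ∘ onThere))

    suffix : ∀ {x y u} (q : Path H x y) → On u q → Σ (Path H u y) λ r → ∀ {t} → On t r → On t q
    suffix q onHere = q , id
    suffix (step e q) (onThere u∈q) with suffix q u∈q
    ... | r , r⊆q = r , onThere ∘ r⊆q

    prefix : ∀ {x y u} (q : Path H x y) → On u q → Σ (Path H x u) λ r → ∀ {t} → On t r → On t q
    prefix q onHere = stop , λ { onHere → onHere }
    prefix (step e q) (onThere u∈q) with prefix q u∈q
    ... | r , r⊆q = step e r , λ { onHere → onHere ; (onThere t∈r) → onThere (r⊆q t∈r) }

    stronglyConnected : StronglyConnected S F
    stronglyConnected x y x∈S y∈S with suffix P (∈vertices⁻ P x∈S) | prefix P (∈vertices⁻ P y∈S)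
    ... | r₁ , r₁⊆P | r₂ , r₂⊆P =
      liftᴾ r₁ (On⇒∈S ∘ r₁⊆P) ++ᴾ step b⟶a∈F (liftᴾ r₂ (On⇒∈S ∘ r₂⊆P))

    connected : UConnected S F
    connected x y x∈S y∈S = Path⇒UPath (λ _ _ e → proj₁ (proj₂ (∈induced⁻ e))) (stronglyConnected x y x∈S y∈S)

    forwardAvoiding : ∀ {x₀ y₀ z x} (q : Path H x₀ y₀) → (∀ {u} → On u q → u ∈ S) → ¬ On z q → On x q →
      UPath (S - z) F x y₀
    forwardAvoiding stop _ _ onHere = stop
    forwardAvoiding (step e q) q⊆S z∉q onHere =
      fwd (lift e (q⊆S onHere) (q⊆S (onThere onHere)))
          (x∈p∧x≢y⇒x∈p-y (q⊆S (onThere onHere)) λ { refl → z∉q (onThere onHere) })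
          (forwardAvoiding q (q⊆S ∘ onThere) (z∉q ∘ onThere) onHere)
    forwardAvoiding (step e q) q⊆S z∉q (onThere x∈q) = forwardAvoiding q (q⊆S ∘ onThere) (z∉q ∘ onThere) x∈q

    -- Deleting z cuts the simple path q into two pieces, each still attached to an end of q.
    toEndAvoiding : ∀ {x₀ y₀ z x} (q : Path H x₀ y₀) → Simple q → (∀ {u} → On u q → u ∈ S) →
      On z q → On x q → x ≢ z →
      UPath (S - z) F x x₀ ⊎ UPath (S - z) F x y₀
    toEndAvoiding stop _ _ onHere onHere x≢z = contradiction refl x≢z
    toEndAvoiding (step e q) _ _ onHere onHere x≢z = contradiction refl x≢z
    toEndAvoiding (step e q) (x₀∉q , _) q⊆S onHere (onThere x∈q) _ = inj₂ (forwardAvoiding q (q⊆S ∘ onThere) x₀∉q x∈q)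
    toEndAvoiding (step e q) _ _ (onThere _) onHere _ = inj₁ stop
    toEndAvoiding (step e q) (x₀∉q , q-simple) q⊆S (onThere z∈q) (onThere x∈q) x≢z
      with toEndAvoiding q q-simple (q⊆S ∘ onThere) z∈q x∈q x≢z
    ... | inj₂ p = inj₂ p
    ... | inj₁ p = inj₁ (p ++ᵁ bwd (lift e (q⊆S onHere) (q⊆S (onThere onHere)))
                                   (x∈p∧x≢y⇒x∈p-y (q⊆S onHere) λ { refl → x₀∉q z∈q }) stop)

    toEnd : ∀ {z x} → z ∈ S → x ∈ S - z → UPath (S - z) F x a ⊎ UPath (S - z) F x b
    toEnd z∈S x∈S-z = toEndAvoiding P P-simple On⇒∈S (∈vertices⁻ P z∈S)
                        (∈vertices⁻ P (x∈p-y⇒x∈p S x∈S-z)) (x∈p-y⇒x≢y S x∈S-z)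

    connectedWithout : ∀ z → z ∈ S → UConnected (S - z) F
    connectedWithout z z∈S x y x∈S-z y∈S-z
      with toEnd z∈S x∈S-z | toEnd z∈S y∈S-z
    ... | inj₁ x⇝a | inj₁ y⇝a = x⇝a ++ᵁ reverseᵁ y∈S-z y⇝a
    ... | inj₂ x⇝b | inj₂ y⇝b = x⇝b ++ᵁ reverseᵁ y∈S-z y⇝b
    ... | inj₁ x⇝a | inj₂ y⇝b =
      x⇝a ++ᵁ bwd b⟶a∈F (x∈p∧x≢y⇒x∈p-y b∈S (UPath-end≢ y⇝b (x∈p-y⇒x≢y S y∈S-z)))
              (reverseᵁ y∈S-z y⇝b)
    ... | inj₂ x⇝b | inj₁ y⇝a =
      x⇝b ++ᵁ fwd b⟶a∈F (x∈p∧x≢y⇒x∈p-y a∈S (UPath-end≢ y⇝a (x∈p-y⇒x≢y S y∈S-z)))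
              (reverseᵁ y∈S-z y⇝a)

    stronglyBiconnected : StronglyBiconnected S F
    stronglyBiconnected = stronglyConnected , connected , connectedWithout

  -- Two strongly biconnected subgraphs sharing two distinct vertices have a strongly
  -- biconnected union: after deleting any vertex z, one shared vertex other than z survives
  -- and connects the two halves.
  module Union {E : EdgeSet n} {S₁ S₂ : Subset n} {F₁ F₂ : EdgeSet n}
    (sub₁ : IsSubgraph E S₁ F₁) (sub₂ : IsSubgraph E S₂ F₂)
    (sb₁ : StronglyBiconnected S₁ F₁) (sb₂ : StronglyBiconnected S₂ F₂)
    {a b : Fin n} (a∈S₁ : a ∈ S₁) (a∈S₂ : a ∈ S₂) (b∈S₁ : b ∈ S₁) (b∈S₂ : b ∈ S₂) (a≢b : a ≢ b) where

    S : Subset n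
    S = S₁ ∪ S₂

    F : EdgeSet n
    F = F₁ ∪ᴱ F₂

    S₁⊆S : ∀ {u} → u ∈ S₁ → u ∈ S
    S₁⊆S m = x∈p∪q⁺ (inj₁ m)

    S₂⊆S : ∀ {u} → u ∈ S₂ → u ∈ S
    S₂⊆S m = x∈p∪q⁺ (inj₂ m)

    isSubgraph : IsSubgraph E S F
    isSubgraph = (λ u y e → inE u y (∪ᴱ⁻ {F₁} {F₂} e)) , λ u y e → ends u y (∪ᴱ⁻ {F₁} {F₂} e)
      where
      inE : ∀ u y → u ⟶ y ∈E F₁ ⊎ u ⟶ y ∈E F₂ → u ⟶ y ∈E E
      inE u y (inj₁ e) = proj₁ sub₁ u y e
      inE u y (inj₂ e) = proj₁ sub₂ u y e
      ends : ∀ u y → u ⟶ y ∈E F₁ ⊎ u ⟶ y ∈E F₂ → u ∈ S × y ∈ S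
      ends u y (inj₁ e) = S₁⊆S (proj₁ (proj₂ sub₁ u y e)) , S₁⊆S (proj₂ (proj₂ sub₁ u y e))
      ends u y (inj₂ e) = S₂⊆S (proj₁ (proj₂ sub₂ u y e)) , S₂⊆S (proj₂ (proj₂ sub₂ u y e))

    toA : ∀ {x} → x ∈ S → Path F x a
    toA {x} m with x∈p∪q⁻ S₁ S₂ m
    ... | inj₁ m₁ = mapᴾ (F⊆F∪ᴱF' {F₁} {F₂}) (proj₁ sb₁ x a m₁ a∈S₁)
    ... | inj₂ m₂ = mapᴾ (F'⊆F∪ᴱF' {F₁} {F₂}) (proj₁ sb₂ x a m₂ a∈S₂)

    fromA : ∀ {y} → y ∈ S → Path F a y
    fromA {y} m with x∈p∪q⁻ S₁ S₂ m
    ... | inj₁ m₁ = mapᴾ (F⊆F∪ᴱF' {F₁} {F₂}) (proj₁ sb₁ a y a∈S₁ m₁)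
    ... | inj₂ m₂ = mapᴾ (F'⊆F∪ᴱF' {F₁} {F₂}) (proj₁ sb₂ a y a∈S₂ m₂)

    stronglyConnected : StronglyConnected S F
    stronglyConnected x y x∈S y∈S = toA x∈S ++ᴾ fromA y∈S

    connected : UConnected S F
    connected x y x∈S y∈S = Path⇒UPath (λ u y e → proj₂ (proj₂ isSubgraph u y e)) (stronglyConnected x y x∈S y∈S)

    connectedWithinWithout : ∀ {Sᵢ Fᵢ} → StronglyBiconnected Sᵢ Fᵢ →
      (∀ {u} → u ∈ Sᵢ → u ∈ S) → Fᵢ ⊆E F →
      ∀ {z x c} → x ∈ Sᵢ → x ≢ z → c ∈ Sᵢ → c ≢ z → UPath (S - z) F x c
    connectedWithinWithout {Sᵢ} sbᵢ Sᵢ⊆S Fᵢ⊆F {z} {x} {c} x∈Sᵢ x≢z c∈Sᵢ c≢z with z ∈? Sᵢ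
    ... | yes z∈Sᵢ = mapᵁ (λ m → x∈p∧x≢y⇒x∈p-y (Sᵢ⊆S (x∈p-y⇒x∈p Sᵢ m)) (x∈p-y⇒x≢y Sᵢ m)) Fᵢ⊆F
                          (proj₂ (proj₂ sbᵢ) z z∈Sᵢ x c
                            (x∈p∧x≢y⇒x∈p-y x∈Sᵢ x≢z) (x∈p∧x≢y⇒x∈p-y c∈Sᵢ c≢z))
    ... | no z∉Sᵢ = mapᵁ (λ m → x∈p∧x≢y⇒x∈p-y (Sᵢ⊆S m) λ { refl → z∉Sᵢ m }) Fᵢ⊆F
                         (proj₁ (proj₂ sbᵢ) x c x∈Sᵢ c∈Sᵢ)

    connectedWithout : ∀ z → z ∈ S → UConnected (S - z) F
    connectedWithout z _ x y x∈S-z y∈S-z = toHub x∈S-z ++ᵁ reverseᵁ y∈S-z (toHub y∈S-z)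
      where
      hub : Σ (Fin n) λ c → c ∈ S₁ × c ∈ S₂ × c ≢ z
      hub with z ≟ a
      ... | yes refl = b , b∈S₁ , b∈S₂ , a≢b ∘ sym
      ... | no z≢a = a , a∈S₁ , a∈S₂ , z≢a ∘ sym
      toHub : ∀ {x} → x ∈ S - z → UPath (S - z) F x (proj₁ hub)
      toHub {x} m with hub | x∈p∪q⁻ S₁ S₂ (x∈p-y⇒x∈p S m)
      ... | c , c∈S₁ , _ , c≢z | inj₁ m₁ =
        connectedWithinWithout sb₁ S₁⊆S (F⊆F∪ᴱF' {F₁} {F₂}) m₁ (x∈p-y⇒x≢y S m) c∈S₁ c≢z
      ... | c , _ , c∈S₂ , c≢z | inj₂ m₂ =
        connectedWithinWithout sb₂ S₂⊆S (F'⊆F∪ᴱF' {F₁} {F₂}) m₂ (x∈p-y⇒x≢y S m) c∈S₂ c≢z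

    stronglyBiconnected : StronglyBiconnected S F
    stronglyBiconnected = stronglyConnected , connected , connectedWithout

  IsSBC-absorbs : ∀ {E S F S' F'} → IsSBC E (S , F) → IsSubgraph E S' F' → StronglyBiconnected S' F' →
    ∀ {a b} → a ∈ S → a ∈ S' → b ∈ S → b ∈ S' → a ≢ b → S' ⊆ S × F' ⊆E F
  IsSBC-absorbs {E} {S} {F} {S'} {F'} (sub , sb , maximal) sub' sb' a∈S a∈S' b∈S b∈S' a≢b =
    (λ {x} x∈S' → subst (λ C → x ∈ proj₁ C) union≡C (∪.S₂⊆S x∈S')) ,
    (λ u y e → subst (λ C → u ⟶ y ∈E proj₂ C) union≡C (F'⊆F∪ᴱF' {F} {F'} u y e))
    where
    module ∪ = Union {E = E} sub sub' sb sb' a∈S a∈S' b∈S b∈S' a≢b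
    union≡C : (∪.S , ∪.F) ≡ (S , F)
    union≡C = maximal ∪.S ∪.F ∪.isSubgraph ∪.stronglyBiconnected ∪.S₁⊆S (F⊆F∪ᴱF' {F} {F'})

  IsSBC-unique : ∀ {E C C'} → IsSBC E C → IsSBC E C' →
    ∀ {a b} → a ∈ proj₁ C → a ∈ proj₁ C' → b ∈ proj₁ C → b ∈ proj₁ C' → a ≢ b → C ≡ C'
  IsSBC-unique {E} {S , F} {S' , F'} isC@(sub , sb , _) (sub' , sb' , maximal') a∈S a∈S' b∈S b∈S' a≢b =
    maximal' S F sub sb (proj₁ absorbed) (proj₂ absorbed)
    where
    absorbed : S' ⊆ S × F' ⊆E F
    absorbed = IsSBC-absorbs {E} isC sub' sb' a∈S a∈S' b∈S b∈S' a≢b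

  ∅ᴱ : EdgeSet n
  ∅ᴱ = replicate n ⊥

  ∉∅ᴱ : ∀ {u y} → ¬ (u ⟶ y ∈E ∅ᴱ)
  ∉∅ᴱ {u} {y} e = ∉⊥ (subst (y ∈_) (Vec.lookup-replicate u ⊥) e)

  ⁅x⁆-isSubgraph : ∀ E x → IsSubgraph E ⁅ x ⁆ ∅ᴱ
  ⁅x⁆-isSubgraph E x = (λ _ _ e → contradiction e ∉∅ᴱ) , (λ _ _ e → contradiction e ∉∅ᴱ)

  ⁅x⁆-stronglyBiconnected : ∀ x → StronglyBiconnected ⁅ x ⁆ ∅ᴱ
  ⁅x⁆-stronglyBiconnected x =
    (λ a b a∈ b∈ → subst₂ (Path ∅ᴱ) (≡x a∈) (≡x b∈) stop) ,
    (λ a b a∈ b∈ → subst₂ (UPath ⁅ x ⁆ ∅ᴱ) (≡x a∈) (≡x b∈) stop) ,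
    (λ z _ a b a∈ b∈ →
      subst₂ (UPath (⁅ x ⁆ - z) ∅ᴱ) (≡x (x∈p-y⇒x∈p _ a∈)) (≡x (x∈p-y⇒x∈p _ b∈)) stop)
    where
    ≡x : ∀ {a} → a ∈ ⁅ x ⁆ → x ≡ a
    ≡x a∈ = sym (x∈⁅y⁆⇒x≡y x a∈)

  IsSBC-addEdge⇒IsSBC : ∀ {U : EdgeSet n} {v w C} → IsSBC (addEdge U v w) C → ¬ (v ⟶ w ∈E proj₂ C) → IsSBC U C
  IsSBC-addEdge⇒IsSBC {U} {v} {w} {S , F} ((F⊆U+vw , ends) , sb , maximal) v⟶w∉F =
    ((λ u y e → F⊆U u y e (addEdge⁻ {U} (F⊆U+vw u y e))) , ends) , sb ,
    λ S' F' (F'⊆U , ends') → maximal S' F' ((λ u y e → U⊆addEdge {U} u y (F'⊆U u y e)) , ends')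
    where
    F⊆U : ∀ u y → u ⟶ y ∈E F → u ⟶ y ∈E U ⊎ (u ≡ v × y ≡ w) → u ⟶ y ∈E U
    F⊆U u y _ (inj₁ e) = e
    F⊆U u y e (inj₂ (refl , refl)) = contradiction e v⟶w∉F

weight : ∀ {n m} → Vec (Subset n) m → ℕ
weight [] = 0
weight (r ∷ rs) = ∣ r ∣ + weight rs

weight≤ : ∀ {n m} (rs : Vec (Subset n) m) → weight rs ≤ m * n
weight≤ [] = z≤n
weight≤ (r ∷ rs) = ℕ.+-mono-≤ (∣p∣≤n r) (weight≤ rs)

_⊆ᴿ_ : ∀ {n m} → Vec (Subset n) m → Vec (Subset n) m → Set
rs ⊆ᴿ rs' = ∀ i → lookup rs i ⊆ lookup rs' i

weight-mono : ∀ {n m} (rs rs' : Vec (Subset n) m) → rs ⊆ᴿ rs' → weight rs ≤ weight rs'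
weight-mono [] [] _ = z≤n
weight-mono (r ∷ rs) (r' ∷ rs') rs⊆rs' =
  ℕ.+-mono-≤ (p⊆q⇒∣p∣≤∣q∣ (rs⊆rs' zero)) (weight-mono rs rs' (rs⊆rs' ∘ suc))

p⊆q∧p≢q⇒∣p∣<∣q∣ : ∀ {n} {p q : Subset n} → p ⊆ q → p ≢ q → ∣ p ∣ < ∣ q ∣
p⊆q∧p≢q⇒∣p∣<∣q∣ {p = p} {q} p⊆q p≢q with p ⊂? q
... | yes p⊂q = p⊂q⇒∣p∣<∣q∣ p⊂q
... | no p⊄q = contradiction (⊆-antisym p⊆q q⊆p) p≢q
  where
  q⊆p : q ⊆ p
  q⊆p {x} x∈q with x ∈? p
  ... | yes x∈p = x∈p
  ... | no x∉p = contradiction ((λ {y} → p⊆q {y}) , x , x∈q , x∉p) p⊄q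

weight-strict : ∀ {n m} (rs rs' : Vec (Subset n) m) → rs ⊆ᴿ rs' → rs ≢ rs' → weight rs < weight rs'
weight-strict [] [] _ []≢[] = contradiction refl []≢[]
weight-strict (r ∷ rs) (r' ∷ rs') rs⊆rs' rs≢rs' with Vec.≡-dec _≟ᵇ_ r r'
... | yes refl = ℕ.+-monoʳ-< ∣ r ∣ (weight-strict rs rs' (rs⊆rs' ∘ suc) (rs≢rs' ∘ cong (r ∷_)))
... | no r≢r' = ℕ.+-mono-<-≤ (p⊆q∧p≢q⇒∣p∣<∣q∣ (rs⊆rs' zero) r≢r') (weight-mono rs rs' (rs⊆rs' ∘ suc))

open RawMonad (¬¬-Monad {0ℓ}) using (pure; _>>=_)

Graph : ℕ → Set
Graph n = Subset n × EdgeSet n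

_≟ᴳ_ : ∀ {n} (C C' : Graph n) → Dec (C ≡ C')
_≟ᴳ_ = Product.≡-dec (Vec.≡-dec _≟ᵇ_) (Vec.≡-dec (Vec.≡-dec _≟ᵇ_))

_⊑_ : ∀ {n} → Graph n → Graph n → Set
C ⊑ C' = proj₁ C ⊆ proj₁ C' × proj₂ C ⊆E proj₂ C'

-- the vertex set is counted as one more row of the adjacency matrix
size : ∀ {n} → Graph n → ℕ
size (S , F) = weight (S ∷ F)

size≤ : ∀ {n} (C : Graph n) → size C ≤ suc n * n
size≤ (S , F) = weight≤ (S ∷ F)

size-strict : ∀ {n} {C C' : Graph n} → C ⊑ C' → C' ≢ C → size C < size C'
size-strict {C = S , F} {S' , F'} (S⊆S' , F⊆F') C'≢C = weight-strict (S ∷ F) (S' ∷ F') rows≤ λ eq →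
  C'≢C (sym (cong₂ _,_ (Vec.∷-injectiveˡ eq) (Vec.∷-injectiveʳ eq)))
  where
  rows≤ : (S ∷ F) ⊆ᴿ (S' ∷ F')
  rows≤ zero = S⊆S'
  rows≤ (suc u) = F⊆F' u _

module _ {n : ℕ} (E : EdgeSet n) where

  IsSBSubgraph : Graph n → Set
  IsSBSubgraph (S , F) = IsSubgraph E S F × StronglyBiconnected S F

  StrictlyBigger : Graph n → Set
  StrictlyBigger C = Σ (Graph n) λ C' → IsSBSubgraph C' × C ⊑ C' × C' ≢ C

  unextendable⇒IsSBC : ∀ {C} → IsSBSubgraph C → ¬ StrictlyBigger C → IsSBC E C
  unextendable⇒IsSBC {C} (sub , sb) unextendable = sub , sb , λ S' F' sub' sb' S⊆S' F⊆F' →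
    decidable-stable ((S' , F') ≟ᴳ C) λ C'≢C → unextendable ((S' , F') , (sub' , sb') , (S⊆S' , F⊆F') , C'≢C)

  ExtendsTo : Graph n → Set
  ExtendsTo C = Σ (Graph n) λ D → IsSBC E D × C ⊑ D

  -- Classically, a strictly bigger strongly biconnected subgraph exists or not; the fuel k
  -- bounds how often the size can still grow.
  extendBy : ∀ k C → suc n * n ≤ size C + k → IsSBSubgraph C → DoubleNegation (ExtendsTo C)
  extendBy k C bound isC = ¬¬-excluded-middle >>= grow k bound
    where
    grow : ∀ k → suc n * n ≤ size C + k → Dec (StrictlyBigger C) → DoubleNegation (ExtendsTo C)
    grow _ _ (no unextendable) = pure (C , unextendable⇒IsSBC isC unextendable , ((λ {_} m → m) , λ _ _ e → e))
    grow zero bound (yes (C' , _ , C⊑C' , C'≢C)) = contradiction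
      (ℕ.≤-trans (ℕ.≤-trans (size≤ C') bound) (ℕ.≤-reflexive (ℕ.+-identityʳ (size C))))
      (ℕ.<⇒≱ (size-strict C⊑C' C'≢C))
    grow (suc k) bound (yes (C' , isC' , C⊑C'@(S⊆S' , F⊆F') , C'≢C)) =
      extendBy k C' bound' isC' >>= λ { (D , isD , (S'⊆D , F'⊆D)) →
        pure (D , isD , ((λ {_} m → S'⊆D (S⊆S' m)) , λ u y → F'⊆D u y ∘ F⊆F' u y)) }
      where
      bound' : suc n * n ≤ size C' + k
      bound' = ℕ.≤-trans bound
        (ℕ.≤-trans (ℕ.≤-reflexive (ℕ.+-suc (size C) k)) (ℕ.+-monoˡ-≤ k (size-strict C⊑C' C'≢C)))

  extend : ∀ {C} → IsSBSubgraph C → DoubleNegation (ExtendsTo C)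
  extend {C} = extendBy (suc n * n) C (ℕ.m≤n+m _ (size C))

  vertex∈SBC : ∀ x → DoubleNegation (Σ (Graph n) λ C → IsSBC E C × x ∈ proj₁ C)
  vertex∈SBC x = extend (⁅x⁆-isSubgraph E x , ⁅x⁆-stronglyBiconnected x) >>= λ { (C , isC , ⁅x⁆⊆C , _) →
    pure (C , isC , ⁅x⁆⊆C (x∈⁅x⁆ x)) }

  edge∈SBC : StronglyConnected ⊤ E → ∀ {x y} → x ⟶ y ∈E E →
    DoubleNegation (Σ (Graph n) λ C → IsSBC E C × x ∈ proj₁ C × y ∈ proj₁ C)
  edge∈SBC E-strong {x} {y} x⟶y = extend (cycle.isSubgraph , cycle.stronglyBiconnected) >>= λ { (C , isC , S⊆C , _) →
    pure (C , isC , S⊆C cycle.b∈S , S⊆C cycle.a∈S) }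
    where
    y⇝x : SimplePath E y x
    y⇝x = simplify (E-strong y x ∈⊤ ∈⊤)
    module cycle = ClosedPath E E (λ _ _ e → e) (proj₁ y⇝x) (proj₂ y⇝x) x⟶y

injective∧missing⇒< : ∀ {k₁ k₂} (f : Fin k₂ → Fin k₁) → Injective _≡_ _≡_ f →
  (i : Fin k₁) → (∀ j → f j ≢ i) → k₂ < k₁
injective∧missing⇒< {suc k₁} f f-injective i i∉f =
  s≤s (injective⇒≤ {f = λ j → punchOut (i∉f j ∘ sym)}
        λ {j} {j'} eq → f-injective (punchOut-injective (i∉f j ∘ sym) (i∉f j' ∘ sym) eq))

HasCount-< : ∀ {A B : Set} {P : A → Set} {Q : B → Set} {k₁ k₂} → HasCount P k₁ → HasCount Q k₂ →
  (f : B → A) → (∀ {y} → Q y → P (f y)) → (∀ {y y'} → Q y → Q y' → f y ≡ f y' → y ≡ y') →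
  ∀ {a} → P a → (∀ {y} → Q y → f y ≢ a) → k₂ < k₁
HasCount-< {P = P} {Q} {k₁} {k₂} (g₁ , _ , P⇔) (g₂ , g₂-injective , Q⇔) f P∘f f-injective {a} Pa a∉f =
  injective∧missing⇒< h h-injective (index Pa) h-misses
  where
  open Equivalence
  open ≡-Reasoning
  index : ∀ {x} → P x → Fin k₁
  index {x} Px = proj₁ (to (P⇔ x) Px)
  g₁∘index : ∀ {x} (Px : P x) → g₁ (index Px) ≡ x
  g₁∘index {x} Px = proj₂ (to (P⇔ x) Px)
  Q∘g₂ : ∀ j → Q (g₂ j)
  Q∘g₂ j = from (Q⇔ (g₂ j)) (j , refl)
  h : Fin k₂ → Fin k₁
  h j = index (P∘f (Q∘g₂ j))
  h-injective : Injective _≡_ _≡_ h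
  h-injective {i} {j} hi≡hj = g₂-injective (f-injective (Q∘g₂ i) (Q∘g₂ j) (begin
    f (g₂ i)  ≡⟨ g₁∘index (P∘f (Q∘g₂ i)) ⟨
    g₁ (h i)  ≡⟨ cong g₁ hi≡hj ⟩
    g₁ (h j)  ≡⟨ g₁∘index (P∘f (Q∘g₂ j)) ⟩
    f (g₂ j)  ∎))
  h-misses : ∀ j → h j ≢ index Pa
  h-misses j hj≡ia = a∉f (Q∘g₂ j) (begin
    f (g₂ j)      ≡⟨ g₁∘index (P∘f (Q∘g₂ j)) ⟨
    g₁ (h j)      ≡⟨ cong g₁ hj≡ia ⟩
    g₁ (index Pa) ≡⟨ g₁∘index Pa ⟩
    a             ∎)

module _ {n : ℕ} {U : EdgeSet n} {v w : Fin n} where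

  fewerSBCs : ∀ {A₀ A₁ k₁ k₂} → v ≢ w →
    IsSBC U A₀ → ¬ IsSBC (addEdge U v w) A₀ → IsSBC U A₁ → ¬ IsSBC (addEdge U v w) A₁ → A₀ ≢ A₁ →
    NumSBC U k₁ → NumSBC (addEdge U v w) k₂ → k₂ < k₁
  fewerSBCs {A₀} {A₁} v≢w isA₀ A₀-dies isA₁ A₁-dies A₀≢A₁ N₁ N₂ =
    HasCount-< N₁ N₂ charge charge-IsSBC charge-injective isA₁ charge-misses
    where
    charge : Graph n → Graph n
    charge C with w ∈? lookup (proj₂ C) v
    ... | yes _ = A₀
    ... | no _ = C

    charge-IsSBC : ∀ {C} → IsSBC (addEdge U v w) C → IsSBC U (charge C)
    charge-IsSBC {C} isC with w ∈? lookup (proj₂ C) v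
    ... | yes _ = isA₀
    ... | no v⟶w∉C = IsSBC-addEdge⇒IsSBC {U = U} isC v⟶w∉C

    charge-injective : ∀ {C C'} → IsSBC (addEdge U v w) C → IsSBC (addEdge U v w) C' → charge C ≡ charge C' → C ≡ C'
    charge-injective {C} {C'} isC isC' eq with w ∈? lookup (proj₂ C) v | w ∈? lookup (proj₂ C') v
    ... | yes v⟶w∈C | yes v⟶w∈C' =
      IsSBC-unique {E = addEdge U v w} isC isC'
        (proj₁ (ends v⟶w∈C)) (proj₁ (ends' v⟶w∈C')) (proj₂ (ends v⟶w∈C)) (proj₂ (ends' v⟶w∈C')) v≢w
      where
      ends : v ⟶ w ∈E proj₂ C → v ∈ proj₁ C × w ∈ proj₁ C
      ends = proj₂ (proj₁ isC) v w
      ends' : v ⟶ w ∈E proj₂ C' → v ∈ proj₁ C' × w ∈ proj₁ C'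
      ends' = proj₂ (proj₁ isC') v w
    ... | yes _ | no _ = contradiction (subst (IsSBC (addEdge U v w)) (sym eq) isC') A₀-dies
    ... | no _ | yes _ = contradiction (subst (IsSBC (addEdge U v w)) eq isC) A₀-dies
    ... | no _ | no _ = eq

    charge-misses : ∀ {C} → IsSBC (addEdge U v w) C → charge C ≢ A₁
    charge-misses {C} isC with w ∈? lookup (proj₂ C) v
    ... | yes _ = A₀≢A₁
    ... | no _ = λ C≡A₁ → A₁-dies (subst (IsSBC (addEdge U v w)) C≡A₁ isC)

  meetsPathTwice⇒¬IsSBC : ¬ (v ⟶ w ∈E U) → (P : Path U w v) → Simple P →
    ∀ {A x y} → IsSBC U A → x ∈ proj₁ A → y ∈ proj₁ A → On x P → On y P → x ≢ y → ¬ IsSBC (addEdge U v w) A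
  meetsPathTwice⇒¬IsSBC v⟶w∉U P P-simple {A} isA x∈A y∈A x∈P y∈P x≢y isA' =
    v⟶w∉U (proj₁ (proj₁ isA) v w (proj₂ absorbed v w cycle.b⟶a∈F))
    where
    module cycle = ClosedPath (addEdge U v w) U (U⊆addEdge {U = U}) P P-simple (∈addEdge {U = U})
    absorbed : cycle.S ⊆ proj₁ A × cycle.F ⊆E proj₂ A
    absorbed = IsSBC-absorbs {E = addEdge U v w} isA' cycle.isSubgraph cycle.stronglyBiconnected
                 x∈A (cycle.On⇒∈S x∈P) y∈A (cycle.On⇒∈S y∈P) x≢y

  numSBC-addEdge-< : StronglyConnected ⊤ U → ¬ (v ⟶ w ∈E U) →
    ¬ (Σ (Graph n) λ C → IsSBC U C × v ∈ proj₁ C × w ∈ proj₁ C) →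
    ∀ {k₁ k₂} → NumSBC U k₁ → NumSBC (addEdge U v w) k₂ → DoubleNegation (k₂ < k₁)
  numSBC-addEdge-< U-strong v⟶w∉U separated {k₁} {k₂} N₁ N₂ =
    v≢w >>= λ v≢w → viaPath v≢w (simplify (U-strong w v ∈⊤ ∈⊤))
    where
    v≢w : DoubleNegation (v ≢ w)
    v≢w = vertex∈SBC U v >>= λ { (C , isC , v∈C) → pure λ { refl → separated (C , isC , v∈C , v∈C) } }

    viaPath : v ≢ w → SimplePath U w v → DoubleNegation (k₂ < k₁)
    viaPath v≢w (stop , _) = contradiction refl v≢w
    viaPath v≢w (P@(step w⟶p P') , P-simple@(w∉P' , _)) with lastEdge P P-simple (v≢w ∘ sym)
    ... | u , u⟶v , u≢v , u∈P =
      edge∈SBC U U-strong w⟶p >>= λ { (A₀ , isA₀ , w∈A₀ , p∈A₀) →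
      edge∈SBC U U-strong u⟶v >>= λ { (A₁ , isA₁ , u∈A₁ , v∈A₁) →
      pure (fewerSBCs v≢w
        isA₀ (meetsPathTwice⇒¬IsSBC v⟶w∉U P P-simple isA₀ w∈A₀ p∈A₀ onHere (onThere onHere)
                λ { refl → w∉P' onHere })
        isA₁ (meetsPathTwice⇒¬IsSBC v⟶w∉U P P-simple isA₁ u∈A₁ v∈A₁ u∈P (On-end P) u≢v)
        (λ A₀≡A₁ → separated (A₁ , isA₁ , v∈A₁ , subst (λ A → w ∈ proj₁ A) A₀≡A₁ w∈A₀))
        N₁ N₂) } }

mainTheorem1 : (n : ℕ) (E U : EdgeSet n) (v w : Fin n) →
    StronglyBiconnected ⊤ E →
    U ⊆E E →
    StronglyConnected ⊤ U →
    ¬ Biconnected ⊤ U →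
    v ⟶ w ∈E E →
    ¬ (v ⟶ w ∈E U) →
    ¬ (Σ (Subset n × EdgeSet n) λ C → IsSBC U C × v ∈ proj₁ C × w ∈ proj₁ C) →
    (k₁ k₂ : ℕ) → NumSBC U k₁ → NumSBC (addEdge U v w) k₂ → k₂ < k₁
mainTheorem1 n E U v w _ _ U-strong _ _ v⟶w∉U separated k₁ k₂ N₁ N₂ =
  decidable-stable (k₂ <? k₁) (numSBC-addEdge-< U-strong v⟶w∉U separated N₁ N₂)
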